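{- Let $Q$ be a Boolean conjunctive query over a distributed schema and $s$ a source. Two $s$-instances are invariant shuffle equivalent (relative to $Q$) if and only if they are $(s,Q)$-equivalent.
   Context: A distributed schema has finitely many sources with pairwise disjoint local schemas $\mathcal{S}_s$; an $s$-instance is an instance of $\mathcal{S}_s$; a context for $s$ is an instance of the union of the other local schemas, and $(I,C)$ is the combined d-instance. $I_1,I_2$ are $(s,Q)$-equivalent if for every context $C$, $(I_1,C)\models Q$ iff $(I_2,C)\models Q$. $\mathrm{SVars}(s,Q)$: variables of $Q$ in atoms over $\mathcal{S}_s$; $\mathrm{SJVars}(s,Q)$: those also occurring in an atom of another source. $\mathrm{CanV}^s(Q)$: conjunction of the atoms of $Q$ over $\mathcal{S}_s$ with variables outside $\mathrm{SJVars}(s,Q)$ existentially quantified. $\mathrm{CanCtxt}^s(Q)$: conjunction of the atoms of $Q$ not over $\mathcal{S}_s$, with variables outside $\mathrm{SJVars}(s,Q)$ existentially quantified. Both have free variables $\mathrm{SJVars}(s,Q)$. A shuffle is a map $\mu:\mathrm{SJVars}(s,Q)\to\mathrm{SJVars}(s,Q)$; $\mu(\varphi)$ replaces each free variable $x$ by $\mu(x)$. For a binding $\sigma$ of $\mathrm{SJVars}(s,Q)$ to elements, $\mu$ is invariant relative to $\langle\sigma,\mathrm{CanCtxt}^s(Q)\rangle$ if for every context $C$ with $C,\sigma\models\mathrm{CanCtxt}^s(Q)$ we have $C,\sigma\models\mu(\mathrm{CanCtxt}^s(Q))$. Two $s$-instances $I_1,I_2$ are invariant shuffle equivalent if whenever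 $I_1,\sigma\models\mathrm{CanV}^s(Q)$ there is a shuffle $\mu$ invariant relative to $\langle\sigma,\mathrm{CanCtxt}^s(Q)\rangle$ with $I_2,\sigma\models\mu(\mathrm{CanV}^s(Q))$, and symmetrically with $I_1,I_2$ swapped. -}

module Defs where

open import Data.Nat using (ℕ)
open import Data.Fin using (Fin)
open import Data.Vec using (Vec; map)
open import Data.Vec.Membership.Propositional using () renaming (_∈_ to _∈ᵥ_)
open import Data.List using (List; _++_)
open import Data.List.Membership.Propositional using (_∈_)
open import Data.List.Relation.Unary.All using (All)
open import Data.Product using (Σ; _×_; ∃; proj₁; proj₂; _,_)
open import Relation.Binary.PropositionalEquality using (_≡_; _≢_)
open import Function using (_∘_)
open import Function.Bundles using (_⇔_)

-- Local schemas S_s = { R | src R ≡ s } are thus pairwise disjoint.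
record DSchema : Set where
  field
    nSrc : ℕ
    nRel : ℕ
    ar   : Fin nRel → ℕ
    src  : Fin nRel → Fin nSrc

module _ (S : DSchema) where
  open DSchema S

  -- The domain of elements is ℕ (a countably infinite domain).
  Fact : Set
  Fact = Σ (Fin nRel) (λ R → Vec ℕ (ar R))

  Instance : Set
  Instance = List Fact

  SInstance : Fin nSrc → Instance → Set
  SInstance s I = All (λ f → src (proj₁ f) ≡ s) I

  Context : Fin nSrc → Instance → Set
  Context s C = All (λ f → src (proj₁ f) ≢ s) C

  -- Atoms of a conjunctive query; variables are natural numbers.
  Atom : Set
  Atom = Σ (Fin nRel) (λ R → Vec ℕ (ar R))

  CQ : Set
  CQ = List Atom

  Valuation : Set
  Valuation = ℕ → ℕ

  HoldsAtom : Valuation → Instance → Atom → Set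
  HoldsAtom ν I (R , xs) = (R , map ν xs) ∈ I

  Models : Instance → CQ → Set
  Models I Q = ∃ λ (ν : Valuation) → All (HoldsAtom ν I) Q

  _⊕_ : Instance → Instance → Instance
  I ⊕ C = I ++ C

  OccursIn : ℕ → Atom → Set
  OccursIn x a = x ∈ᵥ proj₂ a

  SJVar : Fin nSrc → CQ → ℕ → Set
  SJVar s Q x =
    (∃ λ a → a ∈ Q × src (proj₁ a) ≡ s × OccursIn x a) ×
    (∃ λ b → b ∈ Q × src (proj₁ b) ≢ s × OccursIn x b)

  -- Satisfaction, under binding σ of the free variables SJVars(s,Q), of the
  -- conjunction of those atoms of Q satisfying P, with all other variables
  -- existentially quantified.
  PartSat : Fin nSrc → CQ → (Atom → Set) → Instance → Valuation → Set
  PartSat s Q P I σ =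
    ∃ λ (ν : Valuation) →
      (∀ x → SJVar s Q x → ν x ≡ σ x) ×
      All (λ a → P a → HoldsAtom ν I a) Q

  CanVSat : Fin nSrc → CQ → Instance → Valuation → Set
  CanVSat s Q I σ = PartSat s Q (λ a → src (proj₁ a) ≡ s) I σ

  CanCtxtSat : Fin nSrc → CQ → Instance → Valuation → Set
  CanCtxtSat s Q C σ = PartSat s Q (λ a → src (proj₁ a) ≢ s) C σ

  -- A shuffle: a map SJVars(s,Q) → SJVars(s,Q), represented by a function
  -- ℕ → ℕ mapping SJVars into SJVars (values elsewhere are irrelevant).
  Shuffle : Fin nSrc → CQ → Set
  Shuffle s Q = Σ (ℕ → ℕ) (λ μ → ∀ x → SJVar s Q x → SJVar s Q (μ x))

  -- X, σ ⊨ μ(φ) iff X, σ ∘ μ ⊨ φ (μ(φ) replaces free x by μ(x)).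
  -- μ invariant relative to ⟨σ, CanCtxt^s(Q)⟩:
  Invariant : (s : Fin nSrc) (Q : CQ) → Valuation → Shuffle s Q → Set
  Invariant s Q σ μ =
    ∀ C → Context s C → CanCtxtSat s Q C σ → CanCtxtSat s Q C (σ ∘ proj₁ μ)

  ISEDir : Fin nSrc → CQ → Instance → Instance → Set
  ISEDir s Q I₁ I₂ =
    ∀ (σ : Valuation) → CanVSat s Q I₁ σ →
      ∃ λ (μ : Shuffle s Q) → Invariant s Q σ μ × CanVSat s Q I₂ (σ ∘ proj₁ μ)

  InvShuffleEquiv : Fin nSrc → CQ → Instance → Instance → Set
  InvShuffleEquiv s Q I₁ I₂ = ISEDir s Q I₁ I₂ × ISEDir s Q I₂ I₁

  SQEquiv : Fin nSrc → CQ → Instance → Instance → Set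
  SQEquiv s Q I₁ I₂ = ∀ C → Context s C → (Models (I₁ ⊕ C) Q ⇔ Models (I₂ ⊕ C) Q)

-- A model of Q on a d-instance (I , C), with I an s-instance and C a
-- context for s, is the same thing as a binding σ of the shared join
-- variables SJVars(s,Q) together with I, σ ⊨ CanV^s(Q) and C, σ ⊨
-- CanCtxt^s(Q): a model splits into these two parts, and conversely two
-- such parts glue to a model, because their witnesses agree on SJVars.
--
-- (⇒) Splitting a model of (I₁ , C), applying the shuffle μ given by
-- invariant shuffle equivalence and gluing again yields a model of (I₂ , C).
--
-- (⇐) Given I₁, σ ⊨ CanV^s(Q), build the canonical context C₀: the
-- non-s atoms of Q under the renaming θ that is σ on SJVars and sends every
-- other variable to a fresh value N + x above all values of σ and of I₂.
-- Then (I₁ , C₀) ⊨ Q, hence (I₂ , C₀) ⊨ Q via some ν′.  Each ν′ x with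
-- x ∈ SJVars is a small value occurring in C₀, hence equal to σ z for some
-- z ∈ SJVars; choosing such z defines the shuffle μ.  Invariance holds since
-- any context satisfying CanCtxt^s(Q) under σ receives a homomorphism from
-- C₀ that undoes the fresh renaming.

module Submission where

open import Defs
open import Data.Empty using (⊥-elim)
open import Data.Fin using (Fin) renaming (_≟_ to _≟ᶠ_)
open import Data.List using ([]; _∷_; _++_; filter) renaming (map to mapₗ)
open import Data.List.Membership.Propositional using (_∈_; find; lose)
open import Data.List.Membership.Propositional.Properties
  using (∈-++⁻; ∈-++⁺ˡ; ∈-++⁺ʳ; ∈-map⁺; ∈-map∘filter⁺; ∈-map∘filter⁻)
open import Data.List.Relation.Unary.All as All using (All; lookup; tabulate)
open import Data.List.Relation.Unary.Any using (here; there; any?)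
open import Data.Nat using (ℕ; suc; _+_; _∸_; _≤_; _<_; _⊔_; _≤?_)
open import Data.Nat.Properties
  using (m≤m⊔n; m≤n⊔m; <-≤-trans; <⇒≱; m≤m+n; m+n∸m≡n)
import Data.Nat.Properties as ℕₚ
open import Data.Product using (_×_; ∃; proj₁; proj₂; _,_)
open import Data.Sum using (inj₁; inj₂)
open import Data.Vec using (Vec; map) renaming ([] to []ᵥ; _∷_ to _∷ᵥ_)
import Data.Vec.Relation.Unary.Any as Anyᵥ
import Data.Vec.Relation.Unary.Any.Properties as Anyᵥₚ
open import Data.Vec.Membership.Propositional using () renaming (_∈_ to _∈ᵥ_; find to findᵥ)
open import Data.Vec.Membership.Propositional.Properties using () renaming (∈-map⁺ to ∈ᵥ-map⁺)
open import Data.Vec.Membership.DecPropositional ℕₚ._≟_ using () renaming (_∈?_ to _∈ᵥ?_)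
open import Data.Vec.Properties using (map-∘; map-cong)
open import Function using (_∘_)
open import Function.Bundles using (_⇔_; mk⇔; Equivalence)
open import Relation.Nullary using (Dec; yes; no; ¬_; ¬?)
open import Relation.Nullary.Decidable using (_×-dec_; map′)
open import Relation.Binary.PropositionalEquality
  using (_≡_; refl; sym; trans; cong; cong₂; subst; module ≡-Reasoning)

select : {A B : Set} → Dec A → B → B → B
select (yes _) a b = a
select (no _)  a b = b

select-yes : {A B : Set} (d : Dec A) {a b : B} → A → select d a b ≡ a
select-yes (yes _) _  = refl
select-yes (no ¬p) p = ⊥-elim (¬p p)

select-no : {A B : Set} (d : Dec A) {a b : B} → ¬ A → select d a b ≡ b
select-no (yes p) ¬p = ⊥-elim (¬p p)
select-no (no _)  _  = refl

map-cong-∈ : ∀ {n} {f g : ℕ → ℕ} (xs : Vec ℕ n) →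
             (∀ {x} → x ∈ᵥ xs → f x ≡ g x) → map f xs ≡ map g xs
map-cong-∈ []ᵥ       eq = refl
map-cong-∈ (x ∷ᵥ xs) eq = cong₂ _∷ᵥ_ (eq (Anyᵥ.here refl)) (map-cong-∈ xs (eq ∘ Anyᵥ.there))

∈ᵥ-map⁻ : ∀ {n} (f : ℕ → ℕ) (xs : Vec ℕ n) {y} →
          y ∈ᵥ map f xs → ∃ λ x → x ∈ᵥ xs × y ≡ f x
∈ᵥ-map⁻ f xs y∈ = findᵥ (Anyᵥₚ.map⁻ y∈)

vecBound : ∀ {n} (xs : Vec ℕ n) → ∃ λ N → ∀ {v} → v ∈ᵥ xs → v < N
vecBound []ᵥ       = 0 , λ ()
vecBound (x ∷ᵥ xs) with vecBound xs
... | N , below = suc x ⊔ N , λ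
  { (Anyᵥ.here refl) → m≤m⊔n (suc x) N
  ; (Anyᵥ.there v∈)  → <-≤-trans (below v∈) (m≤n⊔m (suc x) N) }

module Facts (S : DSchema) where

  rename : (ℕ → ℕ) → Fact S → Fact S
  rename f (R , xs) = R , map f xs

  rename-∘ : (f g : ℕ → ℕ) (a : Fact S) → rename (f ∘ g) a ≡ rename f (rename g a)
  rename-∘ f g (R , xs) = cong (R ,_) (map-∘ f g xs)

  rename-cong-∈ : {f g : ℕ → ℕ} (a : Fact S) →
                  (∀ {x} → OccursIn S x a → f x ≡ g x) → rename f a ≡ rename g a
  rename-cong-∈ (R , xs) eq = cong (R ,_) (map-cong-∈ xs eq)

  factsBound : (fs : Instance S) →
               ∃ λ N → ∀ {f} → f ∈ fs → ∀ {v} → v ∈ᵥ proj₂ f → v < N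
  factsBound [] = 0 , λ ()
  factsBound ((R , xs) ∷ fs) with vecBound xs | factsBound fs
  ... | M , belowM | N , belowN = M ⊔ N , λ
    { (here refl) v∈ → <-≤-trans (belowM v∈) (m≤m⊔n M N)
    ; (there f∈) v∈  → <-≤-trans (belowN f∈ v∈) (m≤n⊔m M N) }

module Proof (S : DSchema) (s : Fin (DSchema.nSrc S)) (Q : CQ S) where
  open DSchema S
  open Facts S

  Local : Fact S → Set
  Local a = src (proj₁ a) ≡ s

  Local? : ∀ a → Dec (Local a)
  Local? a = src (proj₁ a) ≟ᶠ s

  ∃∈Q? : {P : Atom S → Set} → (∀ a → Dec (P a)) → Dec (∃ λ a → a ∈ Q × P a)
  ∃∈Q? P? = map′ find (λ (a , a∈ , p) → lose a∈ p) (any? P? Q)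

  InLocal : ℕ → Set
  InLocal x = ∃ λ a → a ∈ Q × Local a × OccursIn S x a

  InLocal? : ∀ x → Dec (InLocal x)
  InLocal? x = ∃∈Q? (λ a → Local? a ×-dec (x ∈ᵥ? proj₂ a))

  SJ : ℕ → Set
  SJ = SJVar S s Q

  SJ? : ∀ x → Dec (SJ x)
  SJ? x = InLocal? x ×-dec ∃∈Q? (λ a → ¬? (Local? a) ×-dec (x ∈ᵥ? proj₂ a))

  localFact : ∀ {I C f} → Context S s C → f ∈ _⊕_ S I C → Local f → f ∈ I
  localFact {I} cC f∈ loc with ∈-++⁻ I f∈
  ... | inj₁ f∈I = f∈I
  ... | inj₂ f∈C = ⊥-elim (lookup cC f∈C loc)

  contextFact : ∀ {I C f} → SInstance S s I → f ∈ _⊕_ S I C → ¬ Local f → f ∈ C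
  contextFact {I} sI f∈ nloc with ∈-++⁻ I f∈
  ... | inj₁ f∈I = ⊥-elim (nloc (lookup sI f∈I))
  ... | inj₂ f∈C = f∈C

  localPart : ∀ {I C ν} → Context S s C → All (HoldsAtom S ν (_⊕_ S I C)) Q →
              All (λ a → Local a → HoldsAtom S ν I a) Q
  localPart cC = All.map (localFact cC)

  contextPart : ∀ {I C ν} → SInstance S s I → All (HoldsAtom S ν (_⊕_ S I C)) Q →
                All (λ a → ¬ Local a → HoldsAtom S ν C a) Q
  contextPart sI = All.map (contextFact sI)

  -- The combined valuation follows the first
  -- witness on variables of local atoms and the second elsewhere; on shared
  -- variables both witnesses equal τ.
  glue : ∀ {J C τ} → CanVSat S s Q J τ → CanCtxtSat S s Q C τ → Models S (_⊕_ S J C) Q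
  glue {J} {C} (ν₁ , agree₁ , holds₁) (ν₂ , agree₂ , holds₂) = ν , tabulate holds
    where
    ν : ℕ → ℕ
    ν x = select (InLocal? x) (ν₁ x) (ν₂ x)

    ν≡ν₂ : ∀ {b} → b ∈ Q → ¬ Local b → ∀ {x} → OccursIn S x b → ν x ≡ ν₂ x
    ν≡ν₂ {b} b∈ nloc {x} x∈ with InLocal? x
    ... | yes inLoc = trans (agree₁ x sj) (sym (agree₂ x sj))
      where
      sj : SJ x
      sj = inLoc , (b , b∈ , nloc , x∈)
    ... | no _ = refl

    holds : ∀ {a} → a ∈ Q → HoldsAtom S ν (_⊕_ S J C) a
    holds {a} a∈ with Local? a
    ... | yes loc = ∈-++⁺ˡ (subst (_∈ J) (sym (rename-cong-∈ a ν≡ν₁)) (lookup holds₁ a∈ loc))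
      where
      ν≡ν₁ : ∀ {x} → OccursIn S x a → ν x ≡ ν₁ x
      ν≡ν₁ {x} x∈ = select-yes (InLocal? x) (a , a∈ , loc , x∈)
    ... | no nloc =
      ∈-++⁺ʳ J (subst (_∈ C) (sym (rename-cong-∈ a (ν≡ν₂ a∈ nloc))) (lookup holds₂ a∈ nloc))

  shuffle⇒transfer : ∀ {I J} → SInstance S s I → ISEDir S s Q I J →
                     ∀ C → Context S s C → Models S (_⊕_ S I C) Q → Models S (_⊕_ S J C) Q
  shuffle⇒transfer {I} sI ise C cC (ν , holds) =
    let (_ , invariant , canV-J) = ise ν canV-I
    in glue canV-J (invariant C cC canCtxt-C)
    where
    canV-I : CanVSat S s Q I ν
    canV-I = ν , (λ _ _ → refl) , localPart cC holds
    canCtxt-C : CanCtxtSat S s Q C ν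
    canCtxt-C = ν , (λ _ _ → refl) , contextPart sI holds

  canCtxt : (ℕ → ℕ) → Instance S
  canCtxt θ = mapₗ (rename θ) (filter (¬? ∘ Local?) Q)

  canCtxt⁻ : ∀ {θ f} → f ∈ canCtxt θ → ∃ λ b → b ∈ Q × f ≡ rename θ b × ¬ Local b
  canCtxt⁻ {θ} = ∈-map∘filter⁻ (rename θ) (¬? ∘ Local?) {xs = Q}

  canCtxt⁺ : ∀ {θ b} → b ∈ Q → ¬ Local b → rename θ b ∈ canCtxt θ
  canCtxt⁺ {θ} {b} b∈ nloc =
    ∈-map∘filter⁺ (rename θ) (¬? ∘ Local?) {xs = Q} (b , b∈ , refl , nloc)

  canCtxt-context : ∀ θ → Context S s (canCtxt θ)
  canCtxt-context θ = tabulate λ f∈ →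
    let (_ , _ , f≡ , nloc) = canCtxt⁻ f∈
    in subst (λ f → ¬ Local f) (sym f≡) nloc

  canCtxt-sat : ∀ {θ σ} → (∀ x → SJ x → θ x ≡ σ x) → CanCtxtSat S s Q (canCtxt θ) σ
  canCtxt-sat {θ} agree = θ , agree , tabulate canCtxt⁺

  canCtxt-values : ∀ {θ f v} → f ∈ canCtxt θ → v ∈ᵥ proj₂ f → ∃ λ z → v ≡ θ z
  canCtxt-values {θ} f∈ v∈ with canCtxt⁻ f∈
  ... | (_ , xs) , _ , refl , _ with ∈ᵥ-map⁻ θ xs v∈
  ... | z , _ , v≡ = z , v≡

  canCtxt-hom : ∀ {θ h ν₂ C f} → (∀ z → h (θ z) ≡ ν₂ z) →
                All (λ b → ¬ Local b → HoldsAtom S ν₂ C b) Q →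
                f ∈ canCtxt θ → rename h f ∈ C
  canCtxt-hom {θ} {h} {ν₂} {C} hθ≡ν₂ holds f∈ with canCtxt⁻ f∈
  ... | b , b∈ , refl , nloc = subst (_∈ C) image (lookup holds b∈ nloc)
    where
    open ≡-Reasoning
    image : rename ν₂ b ≡ rename h (rename θ b)
    image = begin
      rename ν₂ b       ≡⟨ cong (proj₁ b ,_) (map-cong (sym ∘ hθ≡ν₂) (proj₂ b)) ⟩
      rename (h ∘ θ) b  ≡⟨ rename-∘ h θ b ⟩
      rename h (rename θ b) ∎

  module Fresh (σ : ℕ → ℕ) (N : ℕ) (σ<N : ∀ {x} → SJ x → σ x < N) where

    θ : ℕ → ℕ
    θ x = select (SJ? x) (σ x) (N + x)

    θ-agrees : ∀ x → SJ x → θ x ≡ σ x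
    θ-agrees x = select-yes (SJ? x)

    θ-fresh : ∀ {x} → ¬ SJ x → θ x ≡ N + x
    θ-fresh {x} = select-no (SJ? x)

    θ-small⇒SJ : ∀ {x} → θ x < N → SJ x
    θ-small⇒SJ {x} small = byCases (SJ? x)
      where
      byCases : Dec (SJ x) → SJ x
      byCases (yes sj) = sj
      byCases (no ¬sj) =
        ⊥-elim (<⇒≱ small (subst (N ≤_) (sym (θ-fresh ¬sj)) (m≤m+n N x)))

    restore : (ℕ → ℕ) → ℕ → ℕ
    restore ν₂ v = select (N ≤? v) (ν₂ (v ∸ N)) v

    restore-small : ∀ ν₂ {v} → v < N → restore ν₂ v ≡ v
    restore-small ν₂ {v} v<N = select-no (N ≤? v) (<⇒≱ v<N)

    restore-θ : ∀ {ν₂} → (∀ x → SJ x → ν₂ x ≡ σ x) → ∀ z → restore ν₂ (θ z) ≡ ν₂ z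
    restore-θ {ν₂} agree z = byCases (SJ? z)
      where
      open ≡-Reasoning
      byCases : Dec (SJ z) → restore ν₂ (θ z) ≡ ν₂ z
      byCases (yes sj) = begin
        restore ν₂ (θ z)    ≡⟨ cong (restore ν₂) (θ-agrees z sj) ⟩
        restore ν₂ (σ z)    ≡⟨ restore-small ν₂ (σ<N sj) ⟩
        σ z                 ≡⟨ sym (agree z sj) ⟩
        ν₂ z                ∎
      byCases (no ¬sj) = begin
        restore ν₂ (θ z)    ≡⟨ cong (restore ν₂) (θ-fresh ¬sj) ⟩
        restore ν₂ (N + z)  ≡⟨ select-yes (N ≤? N + z) (m≤m+n N z) ⟩
        ν₂ (N + z ∸ N)      ≡⟨ cong ν₂ (m+n∸m≡n N z) ⟩
        ν₂ z                ∎

  module Transfer⇒Shuffle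
    (I J : Instance S) (sJ : SInstance S s J)
    (transfer : ∀ C → Context S s C → Models S (_⊕_ S I C) Q → Models S (_⊕_ S J C) Q)
    (σ : ℕ → ℕ) (canV-I : CanVSat S s Q I σ) where

    bound : ∃ λ N → ∀ {f} → f ∈ J ++ mapₗ (rename σ) Q → ∀ {v} → v ∈ᵥ proj₂ f → v < N
    bound = factsBound (J ++ mapₗ (rename σ) Q)

    N : ℕ
    N = proj₁ bound

    σ<N : ∀ {x} → SJ x → σ x < N
    σ<N ((a , a∈ , _ , x∈) , _) =
      proj₂ bound (∈-++⁺ʳ J (∈-map⁺ (rename σ) a∈)) (∈ᵥ-map⁺ σ x∈)

    open Fresh σ N σ<N

    C₀ : Instance S
    C₀ = canCtxt θ

    model-J : Models S (_⊕_ S J C₀) Q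
    model-J = transfer C₀ (canCtxt-context θ) (glue canV-I (canCtxt-sat θ-agrees))

    ν′ : ℕ → ℕ
    ν′ = proj₁ model-J

    localJ : All (λ a → Local a → HoldsAtom S ν′ J a) Q
    localJ = localPart (canCtxt-context θ) (proj₂ model-J)

    nonlocalC₀ : All (λ b → ¬ Local b → HoldsAtom S ν′ C₀ b) Q
    nonlocalC₀ = contextPart sJ (proj₂ model-J)

    -- A shared variable occurs in a local atom, so ν′ sends it into J.
    ν′-small : ∀ {x} → SJ x → ν′ x < N
    ν′-small ((a , a∈ , loc , x∈) , _) =
      proj₂ bound (∈-++⁺ˡ (lookup localJ a∈ loc)) (∈ᵥ-map⁺ ν′ x∈)

    -- It also occurs in a non-local atom, so ν′ sends it into C₀, where the
    -- only small values are σ-images of shared variables.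
    preimage : ∀ {x} → SJ x → ∃ λ z → SJ z × σ z ≡ ν′ x
    preimage {x} sj@(_ , (b , b∈ , nloc , x∈)) = z , sjz , σz≡ν′x
      where
      θ-image : ∃ λ z → ν′ x ≡ θ z
      θ-image = canCtxt-values (lookup nonlocalC₀ b∈ nloc) (∈ᵥ-map⁺ ν′ x∈)
      z : ℕ
      z = proj₁ θ-image
      sjz : SJ z
      sjz = θ-small⇒SJ (subst (_< N) (proj₂ θ-image) (ν′-small sj))
      σz≡ν′x : σ z ≡ ν′ x
      σz≡ν′x = trans (sym (θ-agrees z sjz)) (sym (proj₂ θ-image))

    μ : ℕ → ℕ
    μ x with SJ? x
    ... | yes sj = proj₁ (preimage sj)
    ... | no _   = x

    μ-spec : ∀ {x} → SJ x → SJ (μ x) × σ (μ x) ≡ ν′ x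
    μ-spec {x} sj with SJ? x
    ... | yes sj′ = proj₂ (preimage sj′)
    ... | no ¬sj  = ⊥-elim (¬sj sj)

    shuffle : Shuffle S s Q
    shuffle = μ , λ x sj → proj₁ (μ-spec sj)

    canV-J : CanVSat S s Q J (σ ∘ μ)
    canV-J = ν′ , (λ x sj → sym (proj₂ (μ-spec sj))) , localJ

    -- If C, σ ⊨ CanCtxt^s(Q) via ν₂, then restore ν₂ maps C₀ into C, so
    -- restore ν₂ ∘ ν′ witnesses C, σ ∘ μ ⊨ CanCtxt^s(Q).
    invariant : Invariant S s Q σ shuffle
    invariant C _ (ν₂ , agree₂ , holds₂) = restore ν₂ ∘ ν′ , agree , tabulate holds
      where
      agree : ∀ x → SJ x → restore ν₂ (ν′ x) ≡ σ (μ x)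
      agree x sj = trans (restore-small ν₂ (ν′-small sj)) (sym (proj₂ (μ-spec sj)))

      holds : ∀ {b} → b ∈ Q → ¬ Local b → HoldsAtom S (restore ν₂ ∘ ν′) C b
      holds {b} b∈ nloc = subst (_∈ C) (sym (rename-∘ (restore ν₂) ν′ b))
        (canCtxt-hom (restore-θ agree₂) holds₂ (lookup nonlocalC₀ b∈ nloc))

  transfer⇒shuffle : ∀ {I J} → SInstance S s J →
    (∀ C → Context S s C → Models S (_⊕_ S I C) Q → Models S (_⊕_ S J C) Q) →
    ISEDir S s Q I J
  transfer⇒shuffle {I} {J} sJ transfer σ canV-I = shuffle , invariant , canV-J
    where open Transfer⇒Shuffle I J sJ transfer σ canV-I

mainTheorem5 : (S : DSchema) (Q : CQ S) (s : Fin (DSchema.nSrc S))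
    (I₁ I₂ : Instance S) → SInstance S s I₁ → SInstance S s I₂ →
    InvShuffleEquiv S s Q I₁ I₂ ⇔ SQEquiv S s Q I₁ I₂
mainTheorem5 S Q s I₁ I₂ sI₁ sI₂ = mk⇔ invShuffle⇒SQ SQ⇒invShuffle
  where
  open Proof S s Q

  invShuffle⇒SQ : InvShuffleEquiv S s Q I₁ I₂ → SQEquiv S s Q I₁ I₂
  invShuffle⇒SQ (ise₁₂ , ise₂₁) C cC =
    mk⇔ (shuffle⇒transfer sI₁ ise₁₂ C cC) (shuffle⇒transfer sI₂ ise₂₁ C cC)

  SQ⇒invShuffle : SQEquiv S s Q I₁ I₂ → InvShuffleEquiv S s Q I₁ I₂
  SQ⇒invShuffle sq =
      transfer⇒shuffle sI₂ (λ C cC → Equivalence.to (sq C cC))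
    , transfer⇒shuffle sI₁ (λ C cC → Equivalence.from (sq C cC))
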